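{- Let $d$ be a positive integer. In any grid $\Gamma$ of shape $(\mathbb Z/3\mathbb Z)^d$, the word $\mathsf{ABB}$ has concentration at most $C_1(\mathsf{ABB})\,3^{d-1}=2\cdot 3^{d-2}$.
   Context: A $d$-dimensional grid $\Gamma$ of shape $G=\prod_{i=1}^d\mathbb Z/n_i\mathbb Z$ is a map $\Gamma\colon G\to\Sigma$ to an alphabet; its size is $|G|$. For a word $w=w_0\cdots w_{\ell-1}$, an appearance of $w$ in $\Gamma$ is a pair $(p,\mathbf v)\in G\times(\{ -1,0,1\}^d\setminus\{\mathbf 0\})$ with $\Gamma(p+i\mathbf v)=w_i$ for $0\le i<\ell$ (coordinates reduced modulo the $n_i$). The concentration $c_d(w,\Gamma)$ is the number of appearances divided by $|G|$, and $C_1(w)$ is the supremum of $c_1(w,\Gamma)$ over all one-dimensional grids $\Gamma$; one has $C_1(\mathsf{ABB})=2/3$. -}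

module Defs where

open import Data.Nat using (ℕ; zero; suc; _*_; _^_; _≤_)
open import Data.Fin using (Fin; toℕ; fromℕ<)
import Data.Integer as ℤ
open import Data.Integer using (ℤ; +_; -[1+_])
open import Data.Integer.DivMod using (_%ℕ_; n%ℕd<d)
open import Data.Vec using (Vec; []; _∷_; map; zipWith; allFin)
open import Data.List as List using (List; []; _∷_; length; filter; concatMap; cartesianProduct)
open import Data.List.Relation.Unary.All as All using (All)
open import Data.Product using (_×_; _,_; proj₁; proj₂)
open import Relation.Nullary using (¬_; Dec; yes; no)
open import Relation.Nullary.Decidable using (¬?; _×-dec_)
open import Relation.Binary.PropositionalEquality using (_≡_)
open import Relation.Binary.Definitions using (DecidableEquality)
open import Data.Vec.Properties using () renaming (≡-dec to vec-≡-dec)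
import Data.Fin.Properties as FinP

Point : ℕ → Set
Point d = Vec (Fin 3) d

Grid : ℕ → Set → Set
Grid d Σ = Point d → Σ

-- Direction vectors: elements of {-1,0,1}^d, each entry encoded as Fin 3
-- via  0 ↦ 0, 1 ↦ 1, 2 ↦ -1  (see dirVal).
Dir : ℕ → Set
Dir d = Vec (Fin 3) d

dirVal : Fin 3 → ℤ
dirVal Fin.zero = + 0
dirVal (Fin.suc Fin.zero) = + 1
dirVal (Fin.suc (Fin.suc Fin.zero)) = -[1+ 0 ]

mod3 : ℤ → Fin 3
mod3 z = fromℕ< (n%ℕd<d z 3)

shift : ∀ {d} → Point d → ℕ → Dir d → Point d
shift p i v = zipWith (λ a e → mod3 (+ toℕ a ℤ.+ (+ i) ℤ.* dirVal e)) p v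

zeroDir : ∀ d → Dir d
zeroDir zero = []
zeroDir (suc d) = Fin.zero ∷ zeroDir d

allVecs : ∀ d → List (Vec (Fin 3) d)
allVecs zero = [] ∷ []
allVecs (suc d) = concatMap (λ a → List.map (a ∷_) (allVecs d)) (List.allFin 3)

indexed : ∀ {Σ : Set} → ℕ → List Σ → List (ℕ × Σ)
indexed i [] = []
indexed i (x ∷ w) = (i , x) ∷ indexed (suc i) w

IsAppearance : ∀ {Σ : Set} {d} → List Σ → Grid d Σ → Point d × Dir d → Set
IsAppearance {d = d} w Γ (p , v) =
  ¬ (v ≡ zeroDir d) × All (λ iw → Γ (shift p (proj₁ iw) v) ≡ proj₂ iw) (indexed 0 w)

isAppearance? : ∀ {Σ : Set} (_≟_ : DecidableEquality Σ) {d} (w : List Σ) (Γ : Grid d Σ)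
  → (pv : Point d × Dir d) → Dec (IsAppearance w Γ pv)
isAppearance? _≟_ {d} w Γ (p , v) =
  ¬? (vec-≡-dec FinP._≟_ v (zeroDir d))
  ×-dec All.all? (λ iw → Γ (shift p (proj₁ iw) v) ≟ proj₂ iw) (indexed 0 w)

appearances : ∀ {Σ : Set} → DecidableEquality Σ → ∀ {d} → List Σ → Grid d Σ → ℕ
appearances _≟_ {d} w Γ =
  length (filter (isAppearance? _≟_ w Γ) (cartesianProduct (allVecs d) (allVecs d)))

ABB : ∀ {Σ : Set} → Σ → Σ → List Σ
ABB a b = a ∷ b ∷ b ∷ []

-- Let B = Γ⁻¹(b), β = |B| and M = 3^(d−1). An appearance (p, v) of ABB has p ∉ B and
-- p + v, p + 2v ∈ B. As p + (p + v) + (p + 2v) = 0, it is determined by (y, z) = (p + v, p + 2v) ∈ B²,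
-- and −(y + z) ∉ B; so there are at most β² − Λ appearances, Λ counting the zero-sum triples in B³.
-- For ξ ∈ F₃^d let m_j = |B ∩ {ξ · x = j}|. Schur's inequality for (m₀, m₁, m₂) bounds β³ by twice
-- the number of triples in B³ with ξ · (x + y + z) = 0 plus β times the number of pairs in B² with
-- ξ · x = ξ · y. Summing over ξ, and using that ξ · s = 0 has 3M solutions if s = 0 and M otherwise
-- (orthogonality of the characters of F₃^d), gives β³ ≤ 2MΛ + Mβ². Then
-- 4M(β² − Λ) ≤ 6Mβ² − 2β³ ≤ 8M³ by AM–GM, i.e. there are at most 2M² = 2·3^(d−2)·3^d appearances.

module Submission where

open import Defs
open import Data.Nat using (ℕ; suc; _*_; _^_; _≤_)
open import Relation.Binary.PropositionalEquality using (_≢_)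
open import Relation.Binary.Definitions using (DecidableEquality)

open import Data.Nat using (zero; _+_; z≤n; NonZero)
open import Data.Nat.Properties
open import Algebra.Properties.CommutativeSemigroup *-commutativeSemigroup using (x∙yz≈y∙xz)
open import Data.Nat.ListAction using (sum)
open import Data.Nat.ListAction.Properties using (sum-++)
open import Data.Nat.Tactic.RingSolver using (solve-∀)
import Data.Fin as Fin
open import Data.Fin using (Fin; toℕ)
open import Data.Fin.Properties using (all?) renaming (_≟_ to _≟₃_)
import Data.Integer as ℤ
open import Data.Vec using ([]; _∷_)
open import Data.Vec.Properties using (≡-dec)
open import Data.List as List using (List; []; _∷_; _++_; length; filter; cartesianProduct)
open import Data.List.Properties using (map-++; map-∘; map-cong)
open import Data.List.Relation.Unary.All using ([]; _∷_)
open import Data.Product using (_×_; _,_)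
open import Data.Sum using (inj₁; inj₂)
open import Function using (_∘_)
open import Relation.Nullary using (Dec; yes; no; contradiction)
open import Relation.Nullary.Decidable using (from-yes; ¬?; _→-dec_)
open import Relation.Binary.PropositionalEquality
  using (_≡_; refl; sym; trans; cong; cong₂; subst; subst₂; module ≡-Reasoning)

𝟙 : ∀ {p} {P : Set p} → Dec P → ℕ
𝟙 (yes _) = 1
𝟙 (no _)  = 0

module _ {p} {P : Set p} where

  𝟙-yes : (P? : Dec P) → P → 𝟙 P? ≡ 1
  𝟙-yes (yes _) _  = refl
  𝟙-yes (no ¬p) p′ = contradiction p′ ¬p

  𝟙-idem : (P? : Dec P) → 𝟙 P? * 𝟙 P? ≡ 𝟙 P?
  𝟙-idem (yes _) = refl
  𝟙-idem (no _)  = refl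

  𝟙-¬?-+ : (P? : Dec P) → 𝟙 (¬? P?) + 𝟙 P? ≡ 1
  𝟙-¬?-+ (yes _) = refl
  𝟙-¬?-+ (no _)  = refl

-- Arithmetic in F₃ and F₃^d

F₃ : Set
F₃ = Fin 3

pattern 0₃ = Fin.zero
pattern 1₃ = Fin.suc Fin.zero
pattern 2₃ = Fin.suc (Fin.suc Fin.zero)

infixl 6 _+₃_ _-₃_
infixl 7 _*₃_
infix  8 -₃_

_+₃_ : F₃ → F₃ → F₃
0₃ +₃ b  = b
1₃ +₃ 0₃ = 1₃
1₃ +₃ 1₃ = 2₃
1₃ +₃ 2₃ = 0₃
2₃ +₃ 0₃ = 2₃
2₃ +₃ 1₃ = 0₃
2₃ +₃ 2₃ = 1₃

-₃_ : F₃ → F₃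
-₃ 0₃ = 0₃
-₃ 1₃ = 2₃
-₃ 2₃ = 1₃

_-₃_ : F₃ → F₃ → F₃
a -₃ b = a +₃ -₃ b

_*₃_ : F₃ → F₃ → F₃
0₃ *₃ b = 0₃
1₃ *₃ b = b
2₃ *₃ b = -₃ b

δ : F₃ → F₃ → ℕ
δ a b = 𝟙 (a ≟₃ b)

*₃-distribˡ-+₃ : ∀ a b c → a *₃ (b +₃ c) ≡ a *₃ b +₃ a *₃ c
*₃-distribˡ-+₃ = from-yes (all? λ a → all? λ b → all? λ c → a *₃ (b +₃ c) ≟₃ a *₃ b +₃ a *₃ c)

+₃-interchange : ∀ a b c e → (a +₃ b) +₃ (c +₃ e) ≡ (a +₃ c) +₃ (b +₃ e)
+₃-interchange = from-yes (all? λ a → all? λ b → all? λ c → all? λ e → (a +₃ b) +₃ (c +₃ e) ≟₃ (a +₃ c) +₃ (b +₃ e))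

*₃-negʳ : ∀ a b → a *₃ -₃ b ≡ -₃ (a *₃ b)
*₃-negʳ = from-yes (all? λ a → all? λ b → a *₃ -₃ b ≟₃ -₃ (a *₃ b))

-₃-distrib-+₃ : ∀ a b → -₃ a +₃ -₃ b ≡ -₃ (a +₃ b)
-₃-distrib-+₃ = from-yes (all? λ a → all? λ b → -₃ a +₃ -₃ b ≟₃ -₃ (a +₃ b))

*₃-zeroʳ : ∀ a → a *₃ 0₃ ≡ 0₃
*₃-zeroʳ = from-yes (all? λ a → a *₃ 0₃ ≟₃ 0₃)

line-third₃ : ∀ a b → a +₃ b +₃ b ≡ -₃ (a +₃ (a +₃ b))
line-third₃ = from-yes (all? λ a → all? λ b → a +₃ b +₃ b ≟₃ -₃ (a +₃ (a +₃ b)))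

zero-sum-third₃ : ∀ a b → -₃ (-₃ (a +₃ b) +₃ a) ≡ b
zero-sum-third₃ = from-yes (all? λ a → all? λ b → -₃ (-₃ (a +₃ b) +₃ a) ≟₃ b)

δ-sym : ∀ a b → δ a b ≡ δ b a
δ-sym = from-yes (all? λ a → all? λ b → δ a b ≟ δ b a)

δ-sub : ∀ a b → δ a b ≡ δ (a -₃ b) 0₃
δ-sub = from-yes (all? λ a → all? λ b → δ a b ≟ δ (a -₃ b) 0₃)

δ-neg : ∀ a b → δ (-₃ a) b ≡ δ (a +₃ b) 0₃
δ-neg = from-yes (all? λ a → all? λ b → δ (-₃ a) b ≟ δ (a +₃ b) 0₃)

δ-shift : ∀ u a c → δ (u +₃ a) c ≡ δ a (c -₃ u)
δ-shift = from-yes (all? λ u → all? λ a → all? λ c → δ (u +₃ a) c ≟ δ a (c -₃ u))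

infixl 6 _⊕_
infix  8 ⊖_
infix  7 _·_

_⊕_ : ∀ {d} → Point d → Point d → Point d
[]      ⊕ []      = []
(a ∷ x) ⊕ (b ∷ y) = a +₃ b ∷ x ⊕ y

⊖_ : ∀ {d} → Point d → Point d
⊖ []      = []
⊖ (a ∷ x) = -₃ a ∷ ⊖ x

_·_ : ∀ {d} → Point d → Point d → F₃
[]      · []      = 0₃
(a ∷ ξ) · (b ∷ x) = a *₃ b +₃ ξ · x

0ᵛ : ∀ {d} → Point d
0ᵛ {d} = zeroDir d

_≟ᵛ_ : ∀ {d} → DecidableEquality (Point d)
_≟ᵛ_ = ≡-dec _≟₃_

δᵛ : ∀ {d} → Point d → Point d → ℕ
δᵛ []      []      = 1
δᵛ (a ∷ x) (b ∷ y) = δ a b * δᵛ x y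

·-⊕ʳ : ∀ {d} (ξ x y : Point d) → ξ · (x ⊕ y) ≡ ξ · x +₃ ξ · y
·-⊕ʳ []      []      []      = refl
·-⊕ʳ (a ∷ ξ) (b ∷ x) (c ∷ y) =
  trans (cong₂ _+₃_ (*₃-distribˡ-+₃ a b c) (·-⊕ʳ ξ x y)) (+₃-interchange (a *₃ b) (a *₃ c) (ξ · x) (ξ · y))

·-⊖ʳ : ∀ {d} (ξ x : Point d) → ξ · (⊖ x) ≡ -₃ (ξ · x)
·-⊖ʳ []      []      = refl
·-⊖ʳ (a ∷ ξ) (b ∷ x) = trans (cong₂ _+₃_ (*₃-negʳ a b) (·-⊖ʳ ξ x)) (-₃-distrib-+₃ (a *₃ b) (ξ · x))

·-0ᵛˡ : ∀ {d} (x : Point d) → 0ᵛ · x ≡ 0₃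
·-0ᵛˡ []      = refl
·-0ᵛˡ (_ ∷ x) = ·-0ᵛˡ x

·-0ᵛʳ : ∀ {d} (ξ : Point d) → ξ · 0ᵛ ≡ 0₃
·-0ᵛʳ []      = refl
·-0ᵛʳ (a ∷ ξ) = cong₂ _+₃_ (*₃-zeroʳ a) (·-0ᵛʳ ξ)

line-third : ∀ {d} (p v : Point d) → p ⊕ v ⊕ v ≡ ⊖ (p ⊕ (p ⊕ v))
line-third []      []      = refl
line-third (a ∷ p) (b ∷ v) = cong₂ _∷_ (line-third₃ a b) (line-third p v)

zero-sum-third : ∀ {d} (y z : Point d) → ⊖ (⊖ (y ⊕ z) ⊕ y) ≡ z
zero-sum-third []      []      = refl
zero-sum-third (a ∷ y) (b ∷ z) = cong₂ _∷_ (zero-sum-third₃ a b) (zero-sum-third y z)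

δᵛ-refl : ∀ {d} (x : Point d) → δᵛ x x ≡ 1
δᵛ-refl []      = refl
δᵛ-refl (a ∷ x) = cong₂ _*_ (𝟙-yes (a ≟₃ a) refl) (δᵛ-refl x)

δᵛ-≢ : ∀ {d} {x y : Point d} → x ≢ y → δᵛ x y ≡ 0
δᵛ-≢ {x = []}    {[]}    x≢y = contradiction refl x≢y
δᵛ-≢ {x = a ∷ x} {b ∷ y} x≢y with a ≟₃ b
... | no _     = refl
... | yes refl = trans (*-identityˡ (δᵛ x y)) (δᵛ-≢ (x≢y ∘ cong (a ∷_)))

δᵛ-sub : ∀ {d} (x y : Point d) → δᵛ x y ≡ δᵛ (x ⊕ ⊖ y) 0ᵛ
δᵛ-sub []      []      = refl
δᵛ-sub (a ∷ x) (b ∷ y) = cong₂ _*_ (δ-sub a b) (δᵛ-sub x y)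

δᵛ-neg : ∀ {d} (x y : Point d) → δᵛ (⊖ x) y ≡ δᵛ (x ⊕ y) 0ᵛ
δᵛ-neg []      []      = refl
δᵛ-neg (a ∷ x) (b ∷ y) = cong₂ _*_ (δ-neg a b) (δᵛ-neg x y)

-- A direction coordinate 2 encodes −1 ≡ 2 (mod 3), so p + i·v is computed in F₃^d.
shift-0 : ∀ {d} (p v : Point d) → shift p 0 v ≡ p
shift-0 []      []      = refl
shift-0 (a ∷ p) (e ∷ v) = cong₂ _∷_ (law a e) (shift-0 p v)
  where
  law : ∀ a e → mod3 (ℤ.+ toℕ a ℤ.+ ℤ.+ 0 ℤ.* dirVal e) ≡ a
  law = from-yes (all? λ a → all? λ e → mod3 (ℤ.+ toℕ a ℤ.+ ℤ.+ 0 ℤ.* dirVal e) ≟₃ a)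

shift-1 : ∀ {d} (p v : Point d) → shift p 1 v ≡ p ⊕ v
shift-1 []      []      = refl
shift-1 (a ∷ p) (e ∷ v) = cong₂ _∷_ (law a e) (shift-1 p v)
  where
  law : ∀ a e → mod3 (ℤ.+ toℕ a ℤ.+ ℤ.+ 1 ℤ.* dirVal e) ≡ a +₃ e
  law = from-yes (all? λ a → all? λ e → mod3 (ℤ.+ toℕ a ℤ.+ ℤ.+ 1 ℤ.* dirVal e) ≟₃ a +₃ e)

shift-2 : ∀ {d} (p v : Point d) → shift p 2 v ≡ p ⊕ v ⊕ v
shift-2 []      []      = refl
shift-2 (a ∷ p) (e ∷ v) = cong₂ _∷_ (law a e) (shift-2 p v)
  where
  law : ∀ a e → mod3 (ℤ.+ toℕ a ℤ.+ ℤ.+ 2 ℤ.* dirVal e) ≡ a +₃ e +₃ e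
  law = from-yes (all? λ a → all? λ e → mod3 (ℤ.+ toℕ a ℤ.+ ℤ.+ 2 ℤ.* dirVal e) ≟₃ a +₃ e +₃ e)

-- Sums over F₃ and F₃^d

∑₃ : (F₃ → ℕ) → ℕ
∑₃ f = f 0₃ + f 1₃ + f 2₃

∑₃-cong : ∀ {f g : F₃ → ℕ} → (∀ a → f a ≡ g a) → ∑₃ f ≡ ∑₃ g
∑₃-cong e = cong₂ _+_ (cong₂ _+_ (e 0₃) (e 1₃)) (e 2₃)

∑₃-mono : ∀ {f g : F₃ → ℕ} → (∀ a → f a ≤ g a) → ∑₃ f ≤ ∑₃ g
∑₃-mono e = +-mono-≤ (+-mono-≤ (e 0₃) (e 1₃)) (e 2₃)

∑₃-+ : ∀ f g → ∑₃ (λ a → f a + g a) ≡ ∑₃ f + ∑₃ g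
∑₃-+ f g = shuffle (f 0₃) (g 0₃) (f 1₃) (g 1₃) (f 2₃) (g 2₃)
  where
  shuffle : ∀ a a′ b b′ c c′ → a + a′ + (b + b′) + (c + c′) ≡ a + b + c + (a′ + b′ + c′)
  shuffle = solve-∀

∑₃-*ˡ : ∀ n f → ∑₃ (λ a → n * f a) ≡ n * ∑₃ f
∑₃-*ˡ n f = sym (distrib n (f 0₃) (f 1₃) (f 2₃))
  where
  distrib : ∀ n a b c → n * (a + b + c) ≡ n * a + n * b + n * c
  distrib = solve-∀

∑₃-translate : ∀ t f → ∑₃ (λ a → f (t +₃ a)) ≡ ∑₃ f
∑₃-translate 0₃ f = refl
∑₃-translate 1₃ f = rotate (f 0₃) (f 1₃) (f 2₃)
  where
  rotate : ∀ a b c → b + c + a ≡ a + b + c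
  rotate = solve-∀
∑₃-translate 2₃ f = rotate (f 0₃) (f 1₃) (f 2₃)
  where
  rotate : ∀ a b c → c + a + b ≡ a + b + c
  rotate = solve-∀

∑₃-negate : ∀ f → ∑₃ (λ a → f (-₃ a)) ≡ ∑₃ f
∑₃-negate f = swap (f 0₃) (f 1₃) (f 2₃)
  where
  swap : ∀ a b c → a + c + b ≡ a + b + c
  swap = solve-∀

∑₃-δ : ∀ i (f : F₃ → ℕ) → ∑₃ (λ j → δ i j * f j) ≡ f i
∑₃-δ 0₃ f = select (f 0₃) (f 1₃) (f 2₃)
  where
  select : ∀ a b c → 1 * a + 0 * b + 0 * c ≡ a
  select = solve-∀
∑₃-δ 1₃ f = select (f 0₃) (f 1₃) (f 2₃)
  where
  select : ∀ a b c → 0 * a + 1 * b + 0 * c ≡ b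
  select = solve-∀
∑₃-δ 2₃ f = select (f 0₃) (f 1₃) (f 2₃)
  where
  select : ∀ a b c → 0 * a + 0 * b + 1 * c ≡ c
  select = solve-∀

∑ : ∀ {d} → (Point d → ℕ) → ℕ
∑ {zero}  f = f []
∑ {suc d} f = ∑₃ λ a → ∑ λ x → f (a ∷ x)

∑-cong : ∀ {d} {f g : Point d → ℕ} → (∀ x → f x ≡ g x) → ∑ f ≡ ∑ g
∑-cong {zero}  e = e []
∑-cong {suc d} e = ∑₃-cong λ a → ∑-cong λ x → e (a ∷ x)

∑-mono : ∀ {d} {f g : Point d → ℕ} → (∀ x → f x ≤ g x) → ∑ f ≤ ∑ g
∑-mono {zero}  e = e []
∑-mono {suc d} e = ∑₃-mono λ a → ∑-mono λ x → e (a ∷ x)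

∑-+ : ∀ {d} (f g : Point d → ℕ) → ∑ (λ x → f x + g x) ≡ ∑ f + ∑ g
∑-+ {zero}  f g = refl
∑-+ {suc d} f g =
  trans (∑₃-cong λ a → ∑-+ (λ x → f (a ∷ x)) (λ x → g (a ∷ x)))
        (∑₃-+ (λ a → ∑ λ x → f (a ∷ x)) (λ a → ∑ λ x → g (a ∷ x)))

∑-*ˡ : ∀ {d} n (f : Point d → ℕ) → ∑ (λ x → n * f x) ≡ n * ∑ f
∑-*ˡ {zero}  n f = refl
∑-*ˡ {suc d} n f = trans (∑₃-cong λ a → ∑-*ˡ n (λ x → f (a ∷ x))) (∑₃-*ˡ n (λ a → ∑ λ x → f (a ∷ x)))

∑-*ʳ : ∀ {d} n (f : Point d → ℕ) → ∑ (λ x → f x * n) ≡ ∑ f * n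
∑-*ʳ n f = trans (∑-cong λ x → *-comm (f x) n) (trans (∑-*ˡ n f) (*-comm n (∑ f)))

∑-const : ∀ d n → ∑ {d} (λ _ → n) ≡ 3 ^ d * n
∑-const zero    n = sym (*-identityˡ n)
∑-const (suc d) n = trans (∑₃-cong λ _ → ∑-const d n) (triple (3 ^ d) n)
  where
  triple : ∀ m n → m * n + m * n + m * n ≡ 3 * m * n
  triple = solve-∀

∑-∑₃ : ∀ {d} (f : Point d → F₃ → ℕ) → ∑ (λ x → ∑₃ (f x)) ≡ ∑₃ λ a → ∑ λ x → f x a
∑-∑₃ f = trans (∑-+ (λ x → f x 0₃ + f x 1₃) (λ x → f x 2₃))
               (cong (_+ ∑ λ x → f x 2₃) (∑-+ (λ x → f x 0₃) (λ x → f x 1₃)))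

∑-comm : ∀ {d e} (f : Point d → Point e → ℕ) → ∑ (λ x → ∑ λ y → f x y) ≡ ∑ λ y → ∑ λ x → f x y
∑-comm {zero}  f = refl
∑-comm {suc d} f =
  trans (∑₃-cong λ a → ∑-comm λ x → f (a ∷ x)) (sym (∑-∑₃ λ y a → ∑ λ x → f (a ∷ x) y))

∑-translate : ∀ {d} (t : Point d) (f : Point d → ℕ) → ∑ (λ x → f (t ⊕ x)) ≡ ∑ f
∑-translate []      f = refl
∑-translate (b ∷ t) f =
  trans (∑₃-cong λ a → ∑-translate t λ x → f (b +₃ a ∷ x)) (∑₃-translate b λ a → ∑ λ x → f (a ∷ x))

∑-negate : ∀ {d} (f : Point d → ℕ) → ∑ (λ x → f (⊖ x)) ≡ ∑ f
∑-negate {zero}  f = refl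
∑-negate {suc d} f =
  trans (∑₃-cong λ a → ∑-negate λ x → f (-₃ a ∷ x)) (∑₃-negate λ a → ∑ λ x → f (a ∷ x))

∑-δᵛ : ∀ {d} (w : Point d) (f : Point d → ℕ) → ∑ (λ x → f x * δᵛ w x) ≡ f w
∑-δᵛ []      f = *-identityʳ (f [])
∑-δᵛ (b ∷ w) f = begin
    ∑₃ (λ a → ∑ λ x → f (a ∷ x) * (δ b a * δᵛ w x))
  ≡⟨ ∑₃-cong (λ a → trans (∑-cong λ x → x∙yz≈y∙xz (f (a ∷ x)) (δ b a) (δᵛ w x))
                          (∑-*ˡ (δ b a) λ x → f (a ∷ x) * δᵛ w x)) ⟩
    ∑₃ (λ a → δ b a * ∑ λ x → f (a ∷ x) * δᵛ w x)
  ≡⟨ ∑₃-cong (λ a → cong (δ b a *_) (∑-δᵛ w λ x → f (a ∷ x))) ⟩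
    ∑₃ (λ a → δ b a * f (a ∷ w))
  ≡⟨ ∑₃-δ b (λ a → f (a ∷ w)) ⟩
    f (b ∷ w)
  ∎
  where open ≡-Reasoning

∑-pull : ∀ {d e} (w : Point d → ℕ) (g : Point e → Point d → ℕ) →
         ∑ (λ ξ → ∑ λ x → w x * g ξ x) ≡ ∑ λ x → w x * ∑ λ ξ → g ξ x
∑-pull w g = trans (∑-comm λ ξ x → w x * g ξ x) (∑-cong λ x → ∑-*ˡ (w x) λ ξ → g ξ x)

∑-affine : ∀ {d} (w g : Point d → ℕ) m n → ∑ (λ x → w x * (m + n * g x)) ≡ m * ∑ w + n * ∑ λ x → w x * g x
∑-affine w g m n = begin
    ∑ (λ x → w x * (m + n * g x))
  ≡⟨ ∑-cong (λ x → expand (w x) m n (g x)) ⟩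
    ∑ (λ x → m * w x + n * (w x * g x))
  ≡⟨ ∑-+ (λ x → m * w x) (λ x → n * (w x * g x)) ⟩
    ∑ (λ x → m * w x) + ∑ (λ x → n * (w x * g x))
  ≡⟨ cong₂ _+_ (∑-*ˡ m w) (∑-*ˡ n λ x → w x * g x) ⟩
    m * ∑ w + n * ∑ (λ x → w x * g x)
  ∎
  where
  open ≡-Reasoning
  expand : ∀ w m n g → w * (m + n * g) ≡ m * w + n * (w * g)
  expand = solve-∀

∑-lines : ∀ {d} (f : Point d → Point d → Point d → ℕ) →
          ∑ (λ p → ∑ λ v → f p (p ⊕ v) (p ⊕ v ⊕ v)) ≡ ∑ λ y → ∑ λ z → f (⊖ (y ⊕ z)) y z
∑-lines {d} f = begin
    ∑ (λ p → ∑ λ v → f p (p ⊕ v) (p ⊕ v ⊕ v))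
  ≡⟨ ∑-cong (λ p → ∑-cong λ v → cong (f p (p ⊕ v)) (line-third p v)) ⟩
    ∑ (λ p → ∑ λ v → g p (p ⊕ v))
  ≡⟨ ∑-cong (λ p → ∑-translate p (g p)) ⟩
    ∑ (λ p → ∑ λ y → g p y)
  ≡⟨ ∑-comm g ⟩
    ∑ (λ y → ∑ λ p → g p y)
  ≡⟨ ∑-cong (λ y → sym (trans (∑-translate y λ z → g (⊖ z) y) (∑-negate λ p → g p y))) ⟩
    ∑ (λ y → ∑ λ z → g (⊖ (y ⊕ z)) y)
  ≡⟨ ∑-cong (λ y → ∑-cong λ z → cong (f (⊖ (y ⊕ z)) y) (zero-sum-third y z)) ⟩
    ∑ (λ y → ∑ λ z → f (⊖ (y ⊕ z)) y z)
  ∎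
  where
  open ≡-Reasoning
  g : Point d → Point d → ℕ
  g p y = f p y (⊖ (p ⊕ y))

level : ∀ {d} → (Point d → ℕ) → (Point d → F₃) → F₃ → ℕ
level w u j = ∑ λ x → w x * δ j (u x)

∑-levels : ∀ {d} (w : Point d → ℕ) (u : Point d → F₃) (F : F₃ → ℕ) →
           ∑ (λ x → w x * F (u x)) ≡ ∑₃ λ j → level w u j * F j
∑-levels w u F = begin
    ∑ (λ x → w x * F (u x))
  ≡⟨ ∑-cong (λ x → cong (w x *_) (sym (∑₃-δ (u x) F))) ⟩
    ∑ (λ x → w x * ∑₃ λ j → δ (u x) j * F j)
  ≡⟨ ∑-cong (λ x → trans (sym (∑₃-*ˡ (w x) λ j → δ (u x) j * F j))
                         (∑₃-cong λ j → trans (cong (λ e → w x * (e * F j)) (δ-sym (u x) j))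
                                              (sym (*-assoc (w x) (δ j (u x)) (F j))))) ⟩
    ∑ (λ x → ∑₃ λ j → w x * δ j (u x) * F j)
  ≡⟨ ∑-∑₃ (λ x j → w x * δ j (u x) * F j) ⟩
    ∑₃ (λ j → ∑ λ x → w x * δ j (u x) * F j)
  ≡⟨ ∑₃-cong (λ j → ∑-*ʳ (F j) λ x → w x * δ j (u x)) ⟩
    ∑₃ (λ j → level w u j * F j)
  ∎
  where open ≡-Reasoning

-- Counting solutions of ξ · s = c

∑₃-δ-affine : ∀ a c → a ≢ 0₃ → ∑₃ (λ t → δ 0₃ (c -₃ t *₃ a)) ≡ 1
∑₃-δ-affine = from-yes (all? λ a → all? λ c → ¬? (a ≟₃ 0₃) →-dec ∑₃ (λ t → δ 0₃ (c -₃ t *₃ a)) ≟ 1)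

solutions : ∀ {d} → Point d → F₃ → ℕ
solutions s c = ∑ λ ξ → δ (ξ · s) c

solutions-0ᵛ : ∀ d c → solutions {d} 0ᵛ c ≡ 3 ^ d * δ 0₃ c
solutions-0ᵛ d c = trans (∑-cong λ ξ → cong (λ e → δ e c) (·-0ᵛʳ {d} ξ)) (∑-const d (δ 0₃ c))

solutions-∷ : ∀ {d} a (s : Point d) c → solutions (a ∷ s) c ≡ ∑₃ λ t → solutions s (c -₃ t *₃ a)
solutions-∷ a s c = ∑₃-cong λ t → ∑-cong λ ξ → δ-shift (t *₃ a) (ξ · s) c

solutions-≢0ᵛ : ∀ k (s : Point (suc k)) c → s ≢ 0ᵛ → solutions s c ≡ 3 ^ k
solutions-≢0ᵛ k (a ∷ s) c s≢0 with s ≟ᵛ 0ᵛ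
... | yes refl = begin
    solutions (a ∷ 0ᵛ {k}) c
  ≡⟨ solutions-∷ a (0ᵛ {k}) c ⟩
    ∑₃ (λ t → solutions (0ᵛ {k}) (c -₃ t *₃ a))
  ≡⟨ ∑₃-cong (λ t → solutions-0ᵛ k (c -₃ t *₃ a)) ⟩
    ∑₃ (λ t → 3 ^ k * δ 0₃ (c -₃ t *₃ a))
  ≡⟨ ∑₃-*ˡ (3 ^ k) (λ t → δ 0₃ (c -₃ t *₃ a)) ⟩
    3 ^ k * ∑₃ (λ t → δ 0₃ (c -₃ t *₃ a))
  ≡⟨ cong (3 ^ k *_) (∑₃-δ-affine a c (s≢0 ∘ cong (_∷ 0ᵛ))) ⟩
    3 ^ k * 1
  ≡⟨ *-identityʳ (3 ^ k) ⟩
    3 ^ k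
  ∎
  where open ≡-Reasoning
solutions-≢0ᵛ zero    (a ∷ []) c s≢0 | no []≢[] = contradiction refl []≢[]
solutions-≢0ᵛ (suc k) (a ∷ s)  c s≢0 | no s≢0′  =
  trans (solutions-∷ a s c) (trans (∑₃-cong λ t → solutions-≢0ᵛ k s (c -₃ t *₃ a) s≢0′) (triple (3 ^ k)))
  where
  triple : ∀ m → m + m + m ≡ 3 * m
  triple = solve-∀

solutions-0₃ : ∀ k (s : Point (suc k)) → solutions s 0₃ ≡ 3 ^ k + 2 * 3 ^ k * δᵛ s 0ᵛ
solutions-0₃ k s with s ≟ᵛ 0ᵛ
... | yes refl = trans (solutions-0ᵛ (suc k) 0₃)
                       (trans (split (3 ^ k)) (cong (λ e → 3 ^ k + 2 * 3 ^ k * e) (sym (δᵛ-refl (0ᵛ {suc k})))))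
  where
  split : ∀ m → 3 * m * 1 ≡ m + 2 * m * 1
  split = solve-∀
... | no s≢0 = trans (solutions-≢0ᵛ k s 0₃ s≢0)
                     (trans (pad (3 ^ k)) (cong (λ e → 3 ^ k + 2 * 3 ^ k * e) (sym (δᵛ-≢ s≢0))))
  where
  pad : ∀ m → m ≡ m + 2 * m * 0
  pad = solve-∀

orthogonality₂ : ∀ k (x y : Point (suc k)) → ∑ (λ ξ → δ (ξ · x) (ξ · y)) ≡ 3 ^ k + 2 * 3 ^ k * δᵛ x y
orthogonality₂ k x y = begin
    ∑ (λ ξ → δ (ξ · x) (ξ · y))
  ≡⟨ ∑-cong (λ ξ → trans (δ-sub (ξ · x) (ξ · y)) (cong (λ e → δ e 0₃) (sym (·-difference ξ)))) ⟩
    solutions (x ⊕ ⊖ y) 0₃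
  ≡⟨ solutions-0₃ k (x ⊕ ⊖ y) ⟩
    3 ^ k + 2 * 3 ^ k * δᵛ (x ⊕ ⊖ y) 0ᵛ
  ≡⟨ cong (λ e → 3 ^ k + 2 * 3 ^ k * e) (sym (δᵛ-sub x y)) ⟩
    3 ^ k + 2 * 3 ^ k * δᵛ x y
  ∎
  where
  open ≡-Reasoning
  ·-difference : ∀ ξ → ξ · (x ⊕ ⊖ y) ≡ ξ · x -₃ ξ · y
  ·-difference ξ = trans (·-⊕ʳ ξ x (⊖ y)) (cong (ξ · x +₃_) (·-⊖ʳ ξ y))

orthogonality₃ : ∀ k (x y z : Point (suc k)) →
                 ∑ (λ ξ → δ (-₃ (ξ · x +₃ ξ · y)) (ξ · z)) ≡ 3 ^ k + 2 * 3 ^ k * δᵛ (⊖ (x ⊕ y)) z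
orthogonality₃ k x y z = begin
    ∑ (λ ξ → δ (-₃ (ξ · x +₃ ξ · y)) (ξ · z))
  ≡⟨ ∑-cong (λ ξ → trans (δ-neg (ξ · x +₃ ξ · y) (ξ · z)) (cong (λ e → δ e 0₃) (sym (·-sum ξ)))) ⟩
    solutions (x ⊕ y ⊕ z) 0₃
  ≡⟨ solutions-0₃ k (x ⊕ y ⊕ z) ⟩
    3 ^ k + 2 * 3 ^ k * δᵛ (x ⊕ y ⊕ z) 0ᵛ
  ≡⟨ cong (λ e → 3 ^ k + 2 * 3 ^ k * e) (sym (δᵛ-neg (x ⊕ y) z)) ⟩
    3 ^ k + 2 * 3 ^ k * δᵛ (⊖ (x ⊕ y)) z
  ∎
  where
  open ≡-Reasoning
  ·-sum : ∀ ξ → ξ · (x ⊕ y ⊕ z) ≡ ξ · x +₃ ξ · y +₃ ξ · z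
  ·-sum ξ = trans (·-⊕ʳ ξ (x ⊕ y) z) (cong (_+₃ ξ · z) (·-⊕ʳ ξ x y))

-- Schur's inequality and AM–GM

schurˡ schurʳ : ℕ → ℕ → ℕ → ℕ
schurˡ a b c = a * a * (b + c) + b * b * (c + a) + c * c * (a + b)
schurʳ a b c = a * a * a + b * b * b + c * c * c + 3 * (a * b * c)

schur-sorted : ∀ {a b c} → c ≤ b → b ≤ a → schurˡ a b c ≤ schurʳ a b c
schur-sorted {c = c} c≤b b≤a with s , refl ← m≤n⇒∃[o]m+o≡n c≤b | t , refl ← m≤n⇒∃[o]m+o≡n b≤a =
  subst (schurˡ (c + s + t) (c + s) c ≤_) (sym (gap c s t)) (m≤m+n _ _)
  where
  gap : ∀ c s t →
          (c + s + t) * (c + s + t) * (c + s + t) + (c + s) * (c + s) * (c + s) + c * c * c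
            + 3 * ((c + s + t) * (c + s) * c)
        ≡ (c + s + t) * (c + s + t) * (c + s + c) + (c + s) * (c + s) * (c + (c + s + t))
            + c * c * (c + s + t + (c + s))
            + (c * s * s + c * s * t + c * t * t + 2 * s * t * t + t * t * t)
  gap = solve-∀

schur-swap₁₂ : ∀ a b c → schurˡ a b c ≤ schurʳ a b c → schurˡ b a c ≤ schurʳ b a c
schur-swap₁₂ a b c = subst₂ _≤_ (lhs a b c) (rhs a b c)
  where
  lhs : ∀ a b c → a * a * (b + c) + b * b * (c + a) + c * c * (a + b) ≡ b * b * (a + c) + a * a * (c + b) + c * c * (b + a)
  lhs = solve-∀
  rhs : ∀ a b c → a * a * a + b * b * b + c * c * c + 3 * (a * b * c) ≡ b * b * b + a * a * a + c * c * c + 3 * (b * a * c)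
  rhs = solve-∀

schur-swap₂₃ : ∀ a b c → schurˡ a b c ≤ schurʳ a b c → schurˡ a c b ≤ schurʳ a c b
schur-swap₂₃ a b c = subst₂ _≤_ (lhs a b c) (rhs a b c)
  where
  lhs : ∀ a b c → a * a * (b + c) + b * b * (c + a) + c * c * (a + b) ≡ a * a * (c + b) + c * c * (b + a) + b * b * (a + c)
  lhs = solve-∀
  rhs : ∀ a b c → a * a * a + b * b * b + c * c * c + 3 * (a * b * c) ≡ a * a * a + c * c * c + b * b * b + 3 * (a * c * b)
  rhs = solve-∀

schur-≥ : ∀ {a b} c → b ≤ a → schurˡ a b c ≤ schurʳ a b c
schur-≥ {a} {b} c b≤a with ≤-total c b | ≤-total c a
... | inj₁ c≤b | _        = schur-sorted c≤b b≤a
... | inj₂ b≤c | inj₁ c≤a = schur-swap₂₃ a c b (schur-sorted b≤c c≤a)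
... | inj₂ b≤c | inj₂ a≤c = schur-swap₂₃ a c b (schur-swap₁₂ c a b (schur-sorted b≤a a≤c))

schur : ∀ a b c → schurˡ a b c ≤ schurʳ a b c
schur a b c with ≤-total b a
... | inj₁ b≤a = schur-≥ c b≤a
... | inj₂ a≤b = schur-swap₁₂ b a c (schur-≥ c a≤b)

pairs₃ : (F₃ → ℕ) → ℕ
pairs₃ m = ∑₃ λ i → m i * m i

triples₃ : (F₃ → ℕ) → ℕ
triples₃ m = ∑₃ λ i → m i * ∑₃ λ j → m j * m (-₃ (i +₃ j))

schur₃ : ∀ m → ∑₃ m * ∑₃ m * ∑₃ m ≤ 2 * triples₃ m + ∑₃ m * pairs₃ m
schur₃ m = +-cancelʳ-≤ (2 * schurʳ a b c) _ _
  (≤-trans (≤-reflexive (identity a b c)) (+-monoʳ-≤ (2 * triples₃ m + ∑₃ m * pairs₃ m) (*-monoʳ-≤ 2 (schur a b c))))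
  where
  a b c : ℕ
  a = m 0₃
  b = m 1₃
  c = m 2₃
  identity : ∀ a b c →
      (a + b + c) * (a + b + c) * (a + b + c) + 2 * (a * a * a + b * b * b + c * c * c + 3 * (a * b * c))
    ≡ 2 * (a * (a * a + b * c + c * b) + b * (a * c + b * b + c * a) + c * (a * b + b * a + c * c))
      + (a + b + c) * (a * a + b * b + c * c)
      + 2 * (a * a * (b + c) + b * b * (c + a) + c * c * (a + b))
  identity = solve-∀

amgm : ∀ x y → 3 * y * (x * x) ≤ 2 * (x * x * x) + y * y * y
amgm x y with ≤-total y x
... | inj₁ y≤x with t , refl ← m≤n⇒∃[o]m+o≡n y≤x =
  subst (3 * y * ((y + t) * (y + t)) ≤_) (sym (gap y t)) (m≤m+n _ _)
  where
  gap : ∀ y t → 2 * ((y + t) * (y + t) * (y + t)) + y * y * y ≡ 3 * y * ((y + t) * (y + t)) + t * t * (3 * y + 2 * t)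
  gap = solve-∀
... | inj₂ x≤y with t , refl ← m≤n⇒∃[o]m+o≡n x≤y =
  subst (3 * (x + t) * (x * x) ≤_) (sym (gap x t)) (m≤m+n _ _)
  where
  gap : ∀ x t → 2 * (x * x * x) + (x + t) * (x + t) * (x + t) ≡ 3 * (x + t) * (x * x) + t * t * (3 * x + t)
  gap = solve-∀

complement-bound : ∀ M .{{_ : NonZero M}} {β Λ T} →
                   β * β * β ≤ 2 * M * Λ + M * (β * β) → T + Λ ≡ β * β → T ≤ 2 * M * M
complement-bound M {β} {Λ} {T} Λ-lower T+Λ≡β² =
  *-cancelˡ-≤ (4 * M) {{m*n≢0 4 M}} (+-cancelʳ-≤ (2 * (β * β * β)) _ _ (begin
    4 * M * T + 2 * (β * β * β)
  ≤⟨ +-monoʳ-≤ (4 * M * T) (*-monoʳ-≤ 2 Λ-lower) ⟩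
    4 * M * T + 2 * (2 * M * Λ + M * (β * β))
  ≡⟨ regroup M T Λ (β * β) ⟩
    4 * M * (T + Λ) + 2 * M * (β * β)
  ≡⟨ cong (λ e → 4 * M * e + 2 * M * (β * β)) T+Λ≡β² ⟩
    4 * M * (β * β) + 2 * M * (β * β)
  ≡⟨ collect M (β * β) ⟩
    3 * (2 * M) * (β * β)
  ≤⟨ amgm β (2 * M) ⟩
    2 * (β * β * β) + 2 * M * (2 * M) * (2 * M)
  ≡⟨ cube M (β * β * β) ⟩
    4 * M * (2 * M * M) + 2 * (β * β * β)
  ∎))
  where
  open ≤-Reasoning
  regroup : ∀ M T Λ B → 4 * M * T + 2 * (2 * M * Λ + M * B) ≡ 4 * M * (T + Λ) + 2 * M * B
  regroup = solve-∀
  collect : ∀ M B → 4 * M * B + 2 * M * B ≡ 3 * (2 * M) * B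
  collect = solve-∀
  cube : ∀ M C → 2 * C + 2 * M * (2 * M) * (2 * M) ≡ 4 * M * (2 * M * M) + 2 * C
  cube = solve-∀

-- Zero-sum triples in a subset of F₃^d

module ZeroSumTriples {k} {B : Point (suc k) → Set} (B? : ∀ x → Dec (B x)) where

  M : ℕ
  M = 3 ^ k

  origin : Point (suc k)
  origin = 0ᵛ

  χ : Point (suc k) → ℕ
  χ x = 𝟙 (B? x)

  β : ℕ
  β = ∑ χ

  Λ : ℕ
  Λ = ∑ λ x → χ x * ∑ λ y → χ y * χ (⊖ (x ⊕ y))

  pairs : Point (suc k) → ℕ
  pairs ξ = ∑ λ x → χ x * ∑ λ y → χ y * δ (ξ · x) (ξ · y)

  triples : Point (suc k) → ℕ
  triples ξ = ∑ λ x → χ x * ∑ λ y → χ y * ∑ λ z → χ z * δ (-₃ (ξ · x +₃ ξ · y)) (ξ · z)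

  masses : Point (suc k) → F₃ → ℕ
  masses ξ = level χ (ξ ·_)

  β-masses : ∀ ξ → β ≡ ∑₃ (masses ξ)
  β-masses ξ = begin
      ∑ χ                        ≡⟨ ∑-cong (λ x → sym (*-identityʳ (χ x))) ⟩
      ∑ (λ x → χ x * 1)          ≡⟨ ∑-levels χ (ξ ·_) (λ _ → 1) ⟩
      ∑₃ (λ j → masses ξ j * 1)  ≡⟨ ∑₃-cong (λ j → *-identityʳ (masses ξ j)) ⟩
      ∑₃ (masses ξ)              ∎
    where open ≡-Reasoning

  pairs-masses : ∀ ξ → pairs ξ ≡ pairs₃ (masses ξ)
  pairs-masses ξ = ∑-levels χ (ξ ·_) (masses ξ)

  triples-masses : ∀ ξ → triples ξ ≡ triples₃ (masses ξ)
  triples-masses ξ = begin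
      ∑ (λ x → χ x * ∑ λ y → χ y * masses ξ (-₃ (ξ · x +₃ ξ · y)))
    ≡⟨ ∑-cong (λ x → cong (χ x *_) (∑-levels χ (ξ ·_) λ j → masses ξ (-₃ (ξ · x +₃ j)))) ⟩
      ∑ (λ x → χ x * ∑₃ λ j → masses ξ j * masses ξ (-₃ (ξ · x +₃ j)))
    ≡⟨ ∑-levels χ (ξ ·_) (λ i → ∑₃ λ j → masses ξ j * masses ξ (-₃ (i +₃ j))) ⟩
      triples₃ (masses ξ)
    ∎
    where open ≡-Reasoning

  pairs-origin : pairs origin ≡ β * β
  pairs-origin = begin
      ∑ (λ x → χ x * ∑ λ y → χ y * δ (origin · x) (origin · y))
    ≡⟨ ∑-cong (λ x → cong (χ x *_) (∑-cong λ y → cong (χ y *_) (cong₂ δ (·-0ᵛˡ x) (·-0ᵛˡ y)))) ⟩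
      ∑ (λ x → χ x * ∑ λ y → χ y * 1)
    ≡⟨ ∑-cong (λ x → cong (χ x *_) (∑-cong λ y → *-identityʳ (χ y))) ⟩
      ∑ (λ x → χ x * β)
    ≡⟨ ∑-*ʳ β χ ⟩
      β * β
    ∎
    where open ≡-Reasoning

  triples-origin : triples origin ≡ β * β * β
  triples-origin = begin
      ∑ (λ x → χ x * ∑ λ y → χ y * ∑ λ z → χ z * δ (-₃ (origin · x +₃ origin · y)) (origin · z))
    ≡⟨ ∑-cong (λ x → cong (χ x *_) (∑-cong λ y → cong (χ y *_) (∑-cong λ z → cong (χ z *_)
         (cong₂ δ (cong -₃_ (cong₂ _+₃_ (·-0ᵛˡ x) (·-0ᵛˡ y))) (·-0ᵛˡ z))))) ⟩
      ∑ (λ x → χ x * ∑ λ y → χ y * ∑ λ z → χ z * 1)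
    ≡⟨ ∑-cong (λ x → cong (χ x *_) (∑-cong λ y → cong (χ y *_) (∑-cong λ z → *-identityʳ (χ z)))) ⟩
      ∑ (λ x → χ x * ∑ λ y → χ y * β)
    ≡⟨ ∑-cong (λ x → cong (χ x *_) (∑-*ʳ β χ)) ⟩
      ∑ (λ x → χ x * (β * β))
    ≡⟨ ∑-*ʳ (β * β) χ ⟩
      β * (β * β)
    ≡⟨ sym (*-assoc β β β) ⟩
      β * β * β
    ∎
    where open ≡-Reasoning

  -- At ξ = 0 all of B lies on one level, where Schur's inequality is far from sharp; the exact
  -- count there supplies the term 2β³ that survives the summation over ξ.
  schur-at : ∀ ξ → β * β * β + 2 * (β * β * β) * δᵛ origin ξ ≤ 2 * triples ξ + β * pairs ξ
  schur-at ξ with origin ≟ᵛ ξ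
  ... | yes refl = ≤-reflexive (begin
      β * β * β + 2 * (β * β * β) * δᵛ origin origin
    ≡⟨ cong (λ e → β * β * β + 2 * (β * β * β) * e) (δᵛ-refl origin) ⟩
      β * β * β + 2 * (β * β * β) * 1
    ≡⟨ split β ⟩
      2 * (β * β * β) + β * (β * β)
    ≡⟨ sym (cong₂ (λ t p → 2 * t + β * p) triples-origin pairs-origin) ⟩
      2 * triples origin + β * pairs origin
    ∎)
    where
    open ≡-Reasoning
    split : ∀ b → b * b * b + 2 * (b * b * b) * 1 ≡ 2 * (b * b * b) + b * (b * b)
    split = solve-∀
  ... | no 0≢ξ = begin
      β * β * β + 2 * (β * β * β) * δᵛ origin ξ
    ≡⟨ cong (λ e → β * β * β + 2 * (β * β * β) * e) (δᵛ-≢ 0≢ξ) ⟩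
      β * β * β + 2 * (β * β * β) * 0
    ≡⟨ drop (β * β * β) ⟩
      β * β * β
    ≡⟨ cong (λ b → b * b * b) (β-masses ξ) ⟩
      ∑₃ m * ∑₃ m * ∑₃ m
    ≤⟨ schur₃ m ⟩
      2 * triples₃ m + ∑₃ m * pairs₃ m
    ≡⟨ sym (cong₃ (triples-masses ξ) (β-masses ξ) (pairs-masses ξ)) ⟩
      2 * triples ξ + β * pairs ξ
    ∎
    where
    open ≤-Reasoning
    m : F₃ → ℕ
    m = masses ξ
    drop : ∀ c → c + 2 * c * 0 ≡ c
    drop = solve-∀
    cong₃ : ∀ {t t′ b b′ p p′} → t ≡ t′ → b ≡ b′ → p ≡ p′ → 2 * t + b * p ≡ 2 * t′ + b′ * p′
    cong₃ refl refl refl = refl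

  ∑-pairs : ∑ pairs ≡ M * β * β + 2 * M * β
  ∑-pairs = begin
      ∑ (λ ξ → ∑ λ x → χ x * ∑ λ y → χ y * δ (ξ · x) (ξ · y))
    ≡⟨ ∑-pull χ (λ ξ x → ∑ λ y → χ y * δ (ξ · x) (ξ · y)) ⟩
      ∑ (λ x → χ x * ∑ λ ξ → ∑ λ y → χ y * δ (ξ · x) (ξ · y))
    ≡⟨ ∑-cong (λ x → cong (χ x *_) (trans (∑-pull χ λ ξ y → δ (ξ · x) (ξ · y))
                                          (∑-cong λ y → cong (χ y *_) (orthogonality₂ k x y)))) ⟩
      ∑ (λ x → χ x * ∑ λ y → χ y * (M + 2 * M * δᵛ x y))
    ≡⟨ ∑-cong (λ x → cong (χ x *_) (trans (∑-affine χ (δᵛ x) M (2 * M))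
                                          (cong (λ e → M * β + 2 * M * e) (∑-δᵛ x χ)))) ⟩
      ∑ (λ x → χ x * (M * β + 2 * M * χ x))
    ≡⟨ ∑-affine χ χ (M * β) (2 * M) ⟩
      M * β * β + 2 * M * ∑ (λ x → χ x * χ x)
    ≡⟨ cong (λ e → M * β * β + 2 * M * e) (∑-cong λ x → 𝟙-idem (B? x)) ⟩
      M * β * β + 2 * M * β
    ∎
    where open ≡-Reasoning

  ∑-triples : ∑ triples ≡ M * β * β * β + 2 * M * Λ
  ∑-triples = begin
      ∑ (λ ξ → ∑ λ x → χ x * ∑ λ y → χ y * ∑ λ z → χ z * δ (-₃ (ξ · x +₃ ξ · y)) (ξ · z))
    ≡⟨ ∑-pull χ (λ ξ x → ∑ λ y → χ y * ∑ λ z → χ z * δ (-₃ (ξ · x +₃ ξ · y)) (ξ · z)) ⟩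
      ∑ (λ x → χ x * ∑ λ ξ → ∑ λ y → χ y * ∑ λ z → χ z * δ (-₃ (ξ · x +₃ ξ · y)) (ξ · z))
    ≡⟨ ∑-cong (λ x → cong (χ x *_) (trans (∑-pull χ λ ξ y → ∑ λ z → χ z * δ (-₃ (ξ · x +₃ ξ · y)) (ξ · z))
         (∑-cong λ y → cong (χ y *_) (trans (∑-pull χ λ ξ z → δ (-₃ (ξ · x +₃ ξ · y)) (ξ · z))
           (∑-cong λ z → cong (χ z *_) (orthogonality₃ k x y z)))))) ⟩
      ∑ (λ x → χ x * ∑ λ y → χ y * ∑ λ z → χ z * (M + 2 * M * δᵛ (⊖ (x ⊕ y)) z))
    ≡⟨ ∑-cong (λ x → cong (χ x *_) (∑-cong λ y → cong (χ y *_)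
         (trans (∑-affine χ (δᵛ (⊖ (x ⊕ y))) M (2 * M)) (cong (λ e → M * β + 2 * M * e) (∑-δᵛ (⊖ (x ⊕ y)) χ))))) ⟩
      ∑ (λ x → χ x * ∑ λ y → χ y * (M * β + 2 * M * χ (⊖ (x ⊕ y))))
    ≡⟨ ∑-cong (λ x → cong (χ x *_) (∑-affine χ (λ y → χ (⊖ (x ⊕ y))) (M * β) (2 * M))) ⟩
      ∑ (λ x → χ x * (M * β * β + 2 * M * ∑ λ y → χ y * χ (⊖ (x ⊕ y))))
    ≡⟨ ∑-affine χ (λ x → ∑ λ y → χ y * χ (⊖ (x ⊕ y))) (M * β * β) (2 * M) ⟩
      M * β * β * β + 2 * M * Λ
    ∎
    where open ≡-Reasoning

  Λ-lower : β * β * β ≤ 2 * M * Λ + M * (β * β)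
  Λ-lower = *-cancelˡ-≤ 2 (+-cancelˡ-≤ (3 * M * (β * β * β)) _ _ (begin
      3 * M * (β * β * β) + 2 * (β * β * β)
    ≡⟨ cong₂ _+_ (sym (∑-const (suc k) (β * β * β))) (sym (∑-δᵛ origin λ _ → 2 * (β * β * β))) ⟩
      ∑ {suc k} (λ _ → β * β * β) + ∑ (λ ξ → 2 * (β * β * β) * δᵛ origin ξ)
    ≡⟨ sym (∑-+ {suc k} (λ _ → β * β * β) λ ξ → 2 * (β * β * β) * δᵛ origin ξ) ⟩
      ∑ (λ ξ → β * β * β + 2 * (β * β * β) * δᵛ origin ξ)
    ≤⟨ ∑-mono schur-at ⟩
      ∑ (λ ξ → 2 * triples ξ + β * pairs ξ)
    ≡⟨ ∑-+ (λ ξ → 2 * triples ξ) (λ ξ → β * pairs ξ) ⟩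
      ∑ (λ ξ → 2 * triples ξ) + ∑ (λ ξ → β * pairs ξ)
    ≡⟨ cong₂ _+_ (trans (∑-*ˡ 2 triples) (cong (2 *_) ∑-triples)) (trans (∑-*ˡ β pairs) (cong (β *_) ∑-pairs)) ⟩
      2 * (M * β * β * β + 2 * M * Λ) + β * (M * β * β + 2 * M * β)
    ≡⟨ regroup M β Λ ⟩
      3 * M * (β * β * β) + 2 * (2 * M * Λ + M * (β * β))
    ∎))
    where
    open ≤-Reasoning
    regroup : ∀ M β Λ → 2 * (M * β * β * β + 2 * M * Λ) + β * (M * β * β + 2 * M * β)
                        ≡ 3 * M * (β * β * β) + 2 * (2 * M * Λ + M * (β * β))
    regroup = solve-∀

  χ̄ : Point (suc k) → ℕ
  χ̄ x = 𝟙 (¬? (B? x))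

  incomplete : ℕ
  incomplete = ∑ λ y → ∑ λ z → χ̄ (⊖ (y ⊕ z)) * (χ y * χ z)

  incomplete+Λ : incomplete + Λ ≡ β * β
  incomplete+Λ = begin
      ∑ (λ y → ∑ λ z → χ̄ (w y z) * (χ y * χ z)) + ∑ (λ y → χ y * ∑ λ z → χ z * χ (w y z))
    ≡⟨ cong (incomplete +_) (∑-cong λ y → trans (sym (∑-*ˡ (χ y) λ z → χ z * χ (w y z)))
                                                (∑-cong λ z → rotate (χ y) (χ z) (χ (w y z)))) ⟩
      ∑ (λ y → ∑ λ z → χ̄ (w y z) * (χ y * χ z)) + ∑ (λ y → ∑ λ z → χ (w y z) * (χ y * χ z))
    ≡⟨ sym (∑-+ (λ y → ∑ λ z → χ̄ (w y z) * (χ y * χ z)) (λ y → ∑ λ z → χ (w y z) * (χ y * χ z))) ⟩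
      ∑ (λ y → ∑ (λ z → χ̄ (w y z) * (χ y * χ z)) + ∑ (λ z → χ (w y z) * (χ y * χ z)))
    ≡⟨ ∑-cong (λ y → sym (∑-+ (λ z → χ̄ (w y z) * (χ y * χ z)) (λ z → χ (w y z) * (χ y * χ z)))) ⟩
      ∑ (λ y → ∑ λ z → χ̄ (w y z) * (χ y * χ z) + χ (w y z) * (χ y * χ z))
    ≡⟨ ∑-cong (λ y → ∑-cong λ z → trans (sym (*-distribʳ-+ (χ y * χ z) (χ̄ (w y z)) (χ (w y z))))
                                         (trans (cong (_* (χ y * χ z)) (𝟙-¬?-+ (B? (w y z)))) (*-identityˡ (χ y * χ z)))) ⟩
      ∑ (λ y → ∑ λ z → χ y * χ z)
    ≡⟨ ∑-cong (λ y → ∑-*ˡ (χ y) χ) ⟩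
      ∑ (λ y → χ y * β)
    ≡⟨ ∑-*ʳ β χ ⟩
      β * β
    ∎
    where
    open ≡-Reasoning
    w : Point (suc k) → Point (suc k) → Point (suc k)
    w y z = ⊖ (y ⊕ z)
    rotate : ∀ a b c → a * (b * c) ≡ c * (a * b)
    rotate = solve-∀

  incomplete-bound : incomplete ≤ 2 * M * M
  incomplete-bound = complement-bound M {{m^n≢0 3 k}} {β} Λ-lower incomplete+Λ

-- Appearances of ABB as a sum over lines

length-filter≤sum : ∀ {A : Set} {P : A → Set} (P? : ∀ x → Dec (P x)) (g : A → ℕ) →
                    (∀ x → P x → 1 ≤ g x) → ∀ xs → length (filter P? xs) ≤ sum (List.map g xs)
length-filter≤sum P? g P⇒1≤g []       = z≤n
length-filter≤sum P? g P⇒1≤g (x ∷ xs) with P? x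
... | yes Px = +-mono-≤ (P⇒1≤g x Px) (length-filter≤sum P? g P⇒1≤g xs)
... | no _   = m≤n⇒m≤o+n (g x) (length-filter≤sum P? g P⇒1≤g xs)

sum-map-++ : ∀ {A : Set} (f : A → ℕ) xs ys → sum (List.map f (xs ++ ys)) ≡ sum (List.map f xs) + sum (List.map f ys)
sum-map-++ f xs ys = trans (cong sum (map-++ f xs ys)) (sum-++ (List.map f xs) (List.map f ys))

sum-cartesianProduct : ∀ {A B : Set} (g : A × B → ℕ) xs ys →
  sum (List.map g (cartesianProduct xs ys)) ≡ sum (List.map (λ x → sum (List.map (λ y → g (x , y)) ys)) xs)
sum-cartesianProduct g []       ys = refl
sum-cartesianProduct g (x ∷ xs) ys =
  trans (sum-map-++ g (List.map (x ,_) ys) (cartesianProduct xs ys))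
        (cong₂ _+_ (cong sum (sym (map-∘ {g = g} {f = x ,_} ys))) (sum-cartesianProduct g xs ys))

sum-concatMap : ∀ {A B : Set} (f : B → ℕ) (g : A → List B) xs →
  sum (List.map f (List.concatMap g xs)) ≡ sum (List.map (λ x → sum (List.map f (g x))) xs)
sum-concatMap f g []       = refl
sum-concatMap f g (x ∷ xs) = trans (sum-map-++ f (g x) (List.concatMap g xs)) (cong (_ +_) (sum-concatMap f g xs))

sum-allVecs : ∀ d (f : Point d → ℕ) → sum (List.map f (allVecs d)) ≡ ∑ f
sum-allVecs zero    f = +-identityʳ (f [])
sum-allVecs (suc d) f = begin
    sum (List.map f (allVecs (suc d)))
  ≡⟨ sum-concatMap f (λ a → List.map (a ∷_) (allVecs d)) (List.allFin 3) ⟩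
    sum (List.map (λ a → sum (List.map f (List.map (a ∷_) (allVecs d)))) (List.allFin 3))
  ≡⟨ cong sum (map-cong (λ a → trans (cong sum (sym (map-∘ {g = f} {f = a ∷_} (allVecs d))))
                                     (sum-allVecs d λ x → f (a ∷ x)))
                        (List.allFin 3)) ⟩
    sum (List.map (λ a → ∑ λ x → f (a ∷ x)) (List.allFin 3))
  ≡⟨ assoc (∑ λ x → f (0₃ ∷ x)) (∑ λ x → f (1₃ ∷ x)) (∑ λ x → f (2₃ ∷ x)) ⟩
    ∑ f
  ∎
  where
  open ≡-Reasoning
  assoc : ∀ a b c → a + (b + (c + 0)) ≡ a + b + c
  assoc = solve-∀

appearances-ABB≤ : ∀ {Σ : Set} (_≟_ : DecidableEquality Σ) {d} (Γ : Grid d Σ) {a b : Σ} → a ≢ b →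
  appearances _≟_ (ABB a b) Γ ≤ ∑ λ p → ∑ λ v → 𝟙 (¬? (Γ p ≟ b)) * (𝟙 (Γ (p ⊕ v) ≟ b) * 𝟙 (Γ (p ⊕ v ⊕ v) ≟ b))
appearances-ABB≤ _≟_ {d} Γ {a} {b} a≢b = begin
    length (filter (isAppearance? _≟_ (ABB a b) Γ) (cartesianProduct (allVecs d) (allVecs d)))
  ≤⟨ length-filter≤sum (isAppearance? _≟_ (ABB a b) Γ) g appearance⇒1≤g (cartesianProduct (allVecs d) (allVecs d)) ⟩
    sum (List.map g (cartesianProduct (allVecs d) (allVecs d)))
  ≡⟨ sum-cartesianProduct g (allVecs d) (allVecs d) ⟩
    sum (List.map (λ p → sum (List.map (λ v → g (p , v)) (allVecs d))) (allVecs d))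
  ≡⟨ cong sum (map-cong (λ p → sum-allVecs d λ v → g (p , v)) (allVecs d)) ⟩
    sum (List.map (λ p → ∑ λ v → g (p , v)) (allVecs d))
  ≡⟨ sum-allVecs d (λ p → ∑ λ v → g (p , v)) ⟩
    ∑ (λ p → ∑ λ v → g (p , v))
  ∎
  where
  open ≤-Reasoning
  g : Point d × Dir d → ℕ
  g (p , v) = 𝟙 (¬? (Γ p ≟ b)) * (𝟙 (Γ (p ⊕ v) ≟ b) * 𝟙 (Γ (p ⊕ v ⊕ v) ≟ b))
  appearance⇒1≤g : ∀ pv → IsAppearance (ABB a b) Γ pv → 1 ≤ g pv
  appearance⇒1≤g (p , v) (_ , Γp≡a ∷ Γp+v≡b ∷ Γp+2v≡b ∷ []) =
    ≤-reflexive (sym (cong₂ _*_ (𝟙-yes (¬? (Γ p ≟ b)) Γp≢b)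
                                (cong₂ _*_ (𝟙-yes (Γ (p ⊕ v) ≟ b) (subst (λ q → Γ q ≡ b) (shift-1 p v) Γp+v≡b))
                                           (𝟙-yes (Γ (p ⊕ v ⊕ v) ≟ b) (subst (λ q → Γ q ≡ b) (shift-2 p v) Γp+2v≡b)))))
    where
    Γp≢b : Γ p ≢ b
    Γp≢b Γp≡b = a≢b (trans (sym (subst (λ q → Γ q ≡ a) (shift-0 p v) Γp≡a)) Γp≡b)

proposition2p6 : (k : ℕ) (Σ : Set) (_≟_ : DecidableEquality Σ) (a b : Σ) → a ≢ b
    → (Γ : Grid (suc k) Σ)
    → 9 * appearances _≟_ (ABB a b) Γ ≤ 2 * (3 ^ suc k * 3 ^ suc k)
proposition2p6 k Σ _≟_ a b a≢b Γ = begin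
    9 * appearances _≟_ (ABB a b) Γ
  ≤⟨ *-monoʳ-≤ 9 (appearances-ABB≤ _≟_ Γ a≢b) ⟩
    9 * ∑ (λ p → ∑ λ v → f p (p ⊕ v) (p ⊕ v ⊕ v))
  ≡⟨ cong (9 *_) (∑-lines f) ⟩
    9 * incomplete
  ≤⟨ *-monoʳ-≤ 9 incomplete-bound ⟩
    9 * (2 * M * M)
  ≡⟨ rescale M ⟩
    2 * (3 ^ suc k * 3 ^ suc k)
  ∎
  where
  open ZeroSumTriples (λ x → Γ x ≟ b)
  open ≤-Reasoning
  f : Point (suc k) → Point (suc k) → Point (suc k) → ℕ
  f x y z = χ̄ x * (χ y * χ z)
  rescale : ∀ M → 9 * (2 * M * M) ≡ 2 * (3 * M * (3 * M))
  rescale = solve-∀
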